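{- If $r$ is a rotor type with two states, then $UD(r)$ is balanced.
   Context: A rotor type is an infinite periodic sequence $r=(r^{(1)},r^{(2)},\dots)$ of natural numbers (states), with period $|r|$, indices mod $|r|$; two rotor types are equivalent if one is obtained from the other by an injective relabeling of states. A two-state rotor type is written over the states $\{1,2\}$ with the convention $r^{(1)}=1$. A rotor-router network: a finite digraph, a source vertex, target vertices of outdegree $0$, and at each non-target vertex $v$ a periodic sequence $e_v^{(1)},e_v^{(2)},\dots$ of out-edges; a particle starts at the source, on its $n$-th visit to a non-target vertex $v$ leaves along $e_v^{(n)}$, and whenever it reaches a target it is returned to the source; the hitting sequence is the sequence of targets reached. The compressor network for a two-state $r$ has non-target vertices $1$ (source), $2,3$ and targets $4,5$. On the $n$-th departure: from vertex $1$ the particle goes to vertex $2$ if $r^{(n)}=1$ and to vertex $3$ if $r^{(n)}=2$; from vertex $2$, in variant $U$ it goes to vertex $1$ if $r^{(n)}=1$ and to target $4$ if $r^{(n)}=2$, in variant $D$ to target $4$ if $r^{(n)}=1$ and to vertex $1$ if $r^{(n)}=2$; from vertex $3$ likewise with target $5$ in variant $U$ or $D$. For $X,Y\in\{U,D\}$, $XY(r)$ denotes the hitting sequence of the network with variant $X$ at vertex $2$ and $Y$ at vertex $3$, with $4$ written as $1$ and $5$ as $2$. A two-state rotor type is balanced if its two states occur equally often in a period. -}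

module Defs where

open import Data.Nat using (ℕ; zero; suc; _+_; _<_)
open import Data.Product using (Σ; ∃; _×_; _,_)
open import Data.Sum using (_⊎_; inj₁; inj₂)
open import Relation.Binary.PropositionalEquality using (_≡_)

data St : Set where
  one two : St

-- A two-state rotor type: an infinite periodic sequence over {1,2}
-- (indexed from 0, so r 0 is r^(1)), with the convention r^(1) = 1,
-- and in which both states actually occur.
record TwoStateRotor : Set where
  field
    seq      : ℕ → St
    period   : ℕ
    period>0 : 0 < period
    periodic : ∀ n → seq (n + period) ≡ seq n
    first    : seq 0 ≡ one
    hasTwo   : ∃ λ n → seq n ≡ two

data Variant : Set where
  U D : Variant

data NV : Set where
  v1 v2 v3 : NV

-- Configuration: current (non-target) vertex and the number of
-- departures so far from vertices 1, 2, 3.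
record Config : Set where
  constructor cfg
  field
    at : NV
    c1 c2 c3 : ℕ

initConfig : Config
initConfig = cfg v1 0 0 0

data Move : Set where
  toSource toTarget : Move

varMove : Variant → St → Move
varMove U one = toSource
varMove U two = toTarget
varMove D one = toTarget
varMove D two = toSource

-- One step of the compressor network XY(r): either the particle moves to
-- a non-target vertex (inj₁), or it reaches a target, labelled 1 (vertex 4)
-- or 2 (vertex 5), and is returned to the source (inj₂).
step : Variant → Variant → (ℕ → St) → Config → Config ⊎ (St × Config)
step X Y r (cfg v1 a b c) with r a
... | one = inj₁ (cfg v2 (suc a) b c)
... | two = inj₁ (cfg v3 (suc a) b c)
step X Y r (cfg v2 a b c) with varMove X (r b)
... | toSource = inj₁ (cfg v1 a (suc b) c)
... | toTarget = inj₂ (one , cfg v1 a (suc b) c)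
step X Y r (cfg v3 a b c) with varMove Y (r c)
... | toSource = inj₁ (cfg v1 a b (suc c))
... | toTarget = inj₂ (two , cfg v1 a b (suc c))

data NextHit (X Y : Variant) (r : ℕ → St) : Config → St → Config → Set where
  hit  : ∀ {s t s'} → step X Y r s ≡ inj₂ (t , s') → NextHit X Y r s t s'
  move : ∀ {s s'' t s'} → step X Y r s ≡ inj₁ s'' → NextHit X Y r s'' t s'
       → NextHit X Y r s t s'

-- h is the (infinite) hitting sequence XY(r) (indexed from 0).
IsHittingSeq : Variant → Variant → (ℕ → St) → (ℕ → St) → Set
IsHittingSeq X Y r h =
  Σ (ℕ → Config) λ c → (c 0 ≡ initConfig) × (∀ k → NextHit X Y r (c k) (h k) (c (suc k)))

eqSt : St → St → ℕ
eqSt one one = 1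
eqSt two two = 1
eqSt one two = 0
eqSt two one = 0

count : (ℕ → St) → St → ℕ → ℕ
count h s zero = 0
count h s (suc n) = eqSt (h n) s + count h s n

Balanced : (ℕ → St) → Set
Balanced h = Σ ℕ λ p → (0 < p) × (∀ n → h (n + p) ≡ h n) × (count h one p ≡ count h two p)

-- Every excursion from the source has length two, so the n-th departure from the source
-- happens while the rotors at vertices 2 and 3 have been used a(n) = #{i < n : r i = 1}
-- and b(n) = #{i < n : r i = 2} times; it hits target 1 iff r n = 1 and r (a n) = 2,
-- and target 2 iff r n = 2 and r (b n) = 1. Hence the first n departures hit target 1
-- b(a(n)) times and target 2 a(b(n)) times. The outcome of a departure is periodic in n
-- with period N = |r|², and a(N) = |r| a(|r|), b(N) = |r| b(|r|), so both counts over
-- N departures equal a(|r|) b(|r|). The hitting sequence is the sequence of outcomes with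
-- the returns to the source deleted, periodic with period the number of hits in N
-- departures, over which it therefore hits both targets equally often.
module Submission where

open import Defs
open import Data.Nat using (ℕ; zero; suc; _+_; _*_; _∸_; _≤_; _<_; _≤′_; ≤′-refl; ≤′-step; s≤s; z≤n; NonZero; >-nonZero)
open import Data.Nat.Properties
open import Data.Nat.DivMod using (_%_; _/_; m≡m%n+[m/n]*n; m%n<n)
open import Data.Maybe using (Maybe; just; nothing; maybe′)
open import Data.Maybe.Properties using (just-injective)
open import Data.Product using (Σ; ∃₂; _×_; _,_; proj₁; proj₂; map₂)
open import Data.Sum using (_⊎_; inj₁; inj₂)
open import Data.Empty using (⊥-elim)
open import Function using (_∘_)
open import Relation.Binary.PropositionalEquality
open import Relation.Binary.Definitions using (tri<; tri≈; tri>)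
open ≡-Reasoning

Periodic : ∀ {a} {A : Set a} → (ℕ → A) → ℕ → Set a
Periodic g N = ∀ n → g (n + N) ≡ g n

module _ {a} {A : Set a} {g : ℕ → A} {N : ℕ} (g-periodic : Periodic g N) where

  periodic-* : ∀ m → Periodic g (m * N)
  periodic-* zero    n = cong g (+-identityʳ n)
  periodic-* (suc m) n = begin
    g (n + (N + m * N)) ≡⟨ cong g (+-assoc n N (m * N)) ⟨
    g (n + N + m * N)   ≡⟨ periodic-* m (n + N) ⟩
    g (n + N)           ≡⟨ g-periodic n ⟩
    g n                 ∎

  periodic-% : .{{_ : NonZero N}} → ∀ n → g (n % N) ≡ g n
  periodic-% n = begin
    g (n % N)             ≡⟨ periodic-* (n / N) (n % N) ⟨
    g (n % N + n / N * N) ≡⟨ cong g (m≡m%n+[m/n]*n n N) ⟨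
    g n                   ∎

sum< : (ℕ → ℕ) → ℕ → ℕ
sum< f zero    = 0
sum< f (suc n) = f n + sum< f n

sum<-mono-≤′ : ∀ f {m n} → m ≤′ n → sum< f m ≤ sum< f n
sum<-mono-≤′ f ≤′-refl       = ≤-refl
sum<-mono-≤′ f (≤′-step m≤n) = ≤-trans (sum<-mono-≤′ f m≤n) (m≤n+m _ _)

sum<-pos : ∀ f {i n} → i < n → 0 < f i → 0 < sum< f n
sum<-pos f {i} i<n 0<fi = ≤-trans (≤-trans 0<fi (m≤m+n (f i) _)) (sum<-mono-≤′ f (≤⇒≤′ i<n))

sum<-const-1 : ∀ n → sum< (λ _ → 1) n ≡ n
sum<-const-1 zero    = refl
sum<-const-1 (suc n) = cong suc (sum<-const-1 n)

module _ {f : ℕ → ℕ} {N : ℕ} (f-periodic : Periodic f N) where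

  sum<-+-period : ∀ n → sum< f (n + N) ≡ sum< f n + sum< f N
  sum<-+-period zero    = refl
  sum<-+-period (suc n) = begin
    f (n + N) + sum< f (n + N)     ≡⟨ cong₂ _+_ (f-periodic n) (sum<-+-period n) ⟩
    f n + (sum< f n + sum< f N)    ≡⟨ +-assoc (f n) _ _ ⟨
    f n + sum< f n + sum< f N      ∎

  sum<-*-period : ∀ m → sum< f (m * N) ≡ m * sum< f N
  sum<-*-period zero    = refl
  sum<-*-period (suc m) = begin
    sum< f (N + m * N)          ≡⟨ cong (sum< f) (+-comm N (m * N)) ⟩
    sum< f (m * N + N)          ≡⟨ sum<-+-period (m * N) ⟩
    sum< f (m * N) + sum< f N   ≡⟨ cong (_+ sum< f N) (sum<-*-period m) ⟩
    m * sum< f N + sum< f N     ≡⟨ +-comm (m * sum< f N) _ ⟩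
    sum< f N + m * sum< f N     ∎

count≡sum< : ∀ h s n → count h s n ≡ sum< (λ i → eqSt (h i) s) n
count≡sum< h s zero    = refl
count≡sum< h s (suc n) = cong (eqSt (h n) s +_) (count≡sum< h s n)

data FirstJustFrom {a} {A : Set a} (o : ℕ → Maybe A) : ℕ → ℕ → Set a where
  here  : ∀ {n x} → o n ≡ just x → FirstJustFrom o n n
  later : ∀ {n k} → o n ≡ nothing → FirstJustFrom o (suc n) k → FirstJustFrom o n k

module _ {a} {A : Set a} {o : ℕ → Maybe A} where

  value : ∀ {n k} → FirstJustFrom o n k → A
  value (here {x = x} _) = x
  value (later _ F)      = value F

  value-isJust : ∀ {n k} (F : FirstJustFrom o n k) → o k ≡ just (value F)
  value-isJust (here eq)   = eq
  value-isJust (later _ F) = value-isJust F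

  firstJustFrom-unique : ∀ {n k k′} → FirstJustFrom o n k → FirstJustFrom o n k′ → k ≡ k′
  firstJustFrom-unique (here _)     (here _)     = refl
  firstJustFrom-unique (here j)     (later n _)  with () ← trans (sym j) n
  firstJustFrom-unique (later n _)  (here j)     with () ← trans (sym j) n
  firstJustFrom-unique (later _ F)  (later _ G)  = firstJustFrom-unique F G

  firstJustFrom-exists : ∀ d {n x} → o (d + n) ≡ just x → Σ ℕ (FirstJustFrom o n)
  firstJustFrom-exists zero    eq = _ , here eq
  firstJustFrom-exists (suc d) {n} eq with o n in on
  ... | just _  = n , here on
  ... | nothing = map₂ (later on) (firstJustFrom-exists d (trans (cong o (+-suc d n)) eq))

  firstJustFrom-shift : ∀ {N n k} → Periodic o N → FirstJustFrom o n k → FirstJustFrom o (n + N) (k + N)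
  firstJustFrom-shift per (here eq)    = here (trans (per _) eq)
  firstJustFrom-shift per (later eq F) = later (trans (per _) eq) (firstJustFrom-shift per F)

  sum<-firstJustFrom : ∀ (f : A → ℕ) {n k} → FirstJustFrom o n k → sum< (maybe′ f 0 ∘ o) k ≡ sum< (maybe′ f 0 ∘ o) n
  sum<-firstJustFrom f (here _)           = refl
  sum<-firstJustFrom f (later {n} eq F)   =
    trans (sum<-firstJustFrom f F) (cong (λ m → maybe′ f 0 m + sum< (maybe′ f 0 ∘ o) n) eq)

  just-of-sum<-pos : ∀ (f : A → ℕ) n → 0 < sum< (maybe′ f 0 ∘ o) n → ∃₂ λ i x → o i ≡ just x
  just-of-sum<-pos f (suc n) pos with o n in eq
  ... | just x  = n , x , eq
  ... | nothing = just-of-sum<-pos f n pos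

module Compression {a} {A : Set a} (o : ℕ → Maybe A) {N : ℕ} (0<N : 0 < N)
                   (o-periodic : Periodic o N) {e : ℕ} {x : A} (o-e≡just : o e ≡ just x) where

  private
    instance
      N-nonZero : NonZero N
      N-nonZero = >-nonZero 0<N

  weights-periodic : ∀ (f : A → ℕ) → Periodic (maybe′ f 0 ∘ o) N
  weights-periodic f n = cong (maybe′ f 0) (o-periodic n)

  first : ∀ n → Σ ℕ (FirstJustFrom o n)
  first n = firstJustFrom-exists (e + n * N ∸ n) (begin
    o (e + n * N ∸ n + n) ≡⟨ cong o (m∸n+n≡m (≤-trans (m≤m*n n N) (m≤n+m (n * N) e))) ⟩
    o (e + n * N)         ≡⟨ periodic-* o-periodic n e ⟩
    o e                   ≡⟨ o-e≡just ⟩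
    just x                ∎)

  next : ℕ → ℕ
  next n = proj₁ (first n)

  next-first : ∀ n → FirstJustFrom o n (next n)
  next-first n = proj₂ (first n)

  next-+-period : ∀ n → next (n + N) ≡ next n + N
  next-+-period n = firstJustFrom-unique (next-first (n + N)) (firstJustFrom-shift o-periodic (next-first n))

  start : ℕ → ℕ
  start zero    = 0
  start (suc k) = suc (next (start k))

  position : ℕ → ℕ
  position k = next (start k)

  compressed : ℕ → A
  compressed k = value (next-first (start k))

  compressed-isJust : ∀ k → o (position k) ≡ just (compressed k)
  compressed-isJust k = value-isJust (next-first (start k))

  sum<-position : ∀ (f : A → ℕ) k → sum< (maybe′ f 0 ∘ o) (position k) ≡ sum< (f ∘ compressed) k
  sum<-position f zero    = sum<-firstJustFrom f (next-first 0)
  sum<-position f (suc k) = begin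
    sum< g (position (suc k))                   ≡⟨ sum<-firstJustFrom f (next-first (start (suc k))) ⟩
    maybe′ f 0 (o (position k)) + sum< g (position k)
      ≡⟨ cong₂ _+_ (cong (maybe′ f 0) (compressed-isJust k)) (sum<-position f k) ⟩
    f (compressed k) + sum< (f ∘ compressed) k  ∎
    where
    g : ℕ → ℕ
    g = maybe′ f 0 ∘ o

  justCount : ℕ → ℕ
  justCount = sum< (maybe′ (λ _ → 1) 0 ∘ o)

  justCount-position : ∀ k → justCount (position k) ≡ k
  justCount-position k = trans (sum<-position (λ _ → 1) k) (sum<-const-1 k)

  justCount-strict : ∀ {i j y} → o i ≡ just y → i < j → justCount i < justCount j
  justCount-strict {i} {j} oi i<j =
    subst (_≤ justCount j) (cong (λ m → maybe′ (λ _ → 1) 0 m + justCount i) oi)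
          (sum<-mono-≤′ _ (≤⇒≤′ i<j))

  position-of-justCount : ∀ {j y} → o j ≡ just y → ∀ k → justCount j ≡ k → position k ≡ j
  position-of-justCount {j} oj k jc≡k with <-cmp (position k) j
  ... | tri< lt _ _ = ⊥-elim (<-irrefl refl (subst₂ _<_ (justCount-position k) jc≡k (justCount-strict (compressed-isJust k) lt)))
  ... | tri≈ _ eq _ = eq
  ... | tri> _ _ gt = ⊥-elim (<-irrefl refl (subst₂ _<_ jc≡k (justCount-position k) (justCount-strict oj gt)))

  period : ℕ
  period = justCount N

  position-period : position period ≡ position 0 + N
  position-period = position-of-justCount (trans (o-periodic _) (compressed-isJust 0)) period (begin
    justCount (position 0 + N)    ≡⟨ sum<-+-period (weights-periodic _) (position 0) ⟩
    justCount (position 0) + period ≡⟨ cong (_+ period) (justCount-position 0) ⟩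
    period                        ∎)

  0<period : 0 < period
  0<period = n≢0⇒n>0 λ period≡0 →
    <⇒≢ (m<m+n (position 0) 0<N) (trans (cong position (sym period≡0)) position-period)

  position-+-period : ∀ k → position (k + period) ≡ position k + N
  position-+-period zero    = position-period
  position-+-period (suc k) =
    trans (cong (next ∘ suc) (position-+-period k)) (next-+-period (suc (position k)))

  compressed-periodic : Periodic compressed period
  compressed-periodic k = just-injective (begin
    just (compressed (k + period)) ≡⟨ compressed-isJust (k + period) ⟨
    o (position (k + period))      ≡⟨ cong o (position-+-period k) ⟩
    o (position k + N)             ≡⟨ o-periodic (position k) ⟩
    o (position k)                 ≡⟨ compressed-isJust k ⟩
    just (compressed k)            ∎)

  sum<-compressed-period : ∀ (f : A → ℕ) → sum< (f ∘ compressed) period ≡ sum< (maybe′ f 0 ∘ o) N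
  sum<-compressed-period f = begin
    sum< (f ∘ compressed) period      ≡⟨ sum<-position f period ⟨
    sum< g (position period)          ≡⟨ cong (sum< g) position-period ⟩
    sum< g (position 0 + N)           ≡⟨ sum<-+-period (weights-periodic f) (position 0) ⟩
    sum< g (position 0) + sum< g N    ≡⟨ cong (_+ sum< g N) (sum<-position f 0) ⟩
    sum< g N                          ∎
    where
    g : ℕ → ℕ
    g = maybe′ f 0 ∘ o

towards : St → NV
towards one = v2
towards two = v3

exit : St → Move → Config → Config ⊎ (St × Config)
exit t toSource c = inj₁ c
exit t toTarget c = inj₂ (t , c)

module Departures (X Y : Variant) (r : ℕ → St) where

  step-from₁ : ∀ {a b c s} → r a ≡ s → step X Y r (cfg v1 a b c) ≡ inj₁ (cfg (towards s) (suc a) b c)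
  step-from₁ {a} refl with r a
  ... | one = refl
  ... | two = refl

  step-from₂ : ∀ {a b c s} → r b ≡ s → step X Y r (cfg v2 a b c) ≡ exit one (varMove X s) (cfg v1 a (suc b) c)
  step-from₂ {b = b} refl with varMove X (r b)
  ... | toSource = refl
  ... | toTarget = refl

  step-from₃ : ∀ {a b c s} → r c ≡ s → step X Y r (cfg v3 a b c) ≡ exit two (varMove Y s) (cfg v1 a b (suc c))
  step-from₃ {c = c} refl with varMove Y (r c)
  ... | toSource = refl
  ... | toTarget = refl

hitsOf : St → Maybe St → ℕ
hitsOf s = maybe′ (λ t → eqSt t s) 0

eqSt-pos : ∀ s → 0 < eqSt s s
eqSt-pos one = s≤s z≤n
eqSt-pos two = s≤s z≤n

module UD (R : TwoStateRotor) where
  open TwoStateRotor R renaming (seq to r; period to P; period>0 to 0<P; periodic to r-periodic)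
  open Departures U D r

  occurrences : St → ℕ → ℕ
  occurrences s = sum< (λ i → eqSt (r i) s)

  config : ℕ → Config
  config n = cfg v1 n (occurrences one n) (occurrences two n)

  excursionTarget : St → St → St → Maybe St
  excursionTarget one one _   = nothing
  excursionTarget one two _   = just one
  excursionTarget two _   one = just two
  excursionTarget two _   two = nothing

  -- The target hit by the n-th departure from the source, nothing if the particle returns.
  target : ℕ → Maybe St
  target n = excursionTarget (r n) (r (occurrences one n)) (r (occurrences two n))

  Excursion : Config → Maybe St → Config → Set
  Excursion c (just t) c′ = NextHit U D r c t c′
  Excursion c nothing  c′ = ∀ {t c″} → NextHit U D r c′ t c″ → NextHit U D r c t c″

  excursion : ∀ n → Excursion (config n) (target n) (config (suc n))
  excursion n with r n in e₁ | r (occurrences one n) in e₂ | r (occurrences two n) in e₃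
  ... | one | one | _   = λ k → move (step-from₁ e₁) (move (step-from₂ e₂) k)
  ... | one | two | _   = move (step-from₁ e₁) (hit (step-from₂ e₂))
  ... | two | _   | one = move (step-from₁ e₁) (hit (step-from₃ e₃))
  ... | two | _   | two = λ k → move (step-from₁ e₁) (move (step-from₃ e₃) k)

  nextHit-firstJustFrom : ∀ {n k} (F : FirstJustFrom target n k) → NextHit U D r (config n) (value F) (config (suc k))
  nextHit-firstJustFrom (here {n} eq)    = subst (λ m → Excursion (config n) m (config (suc n))) eq (excursion n)
  nextHit-firstJustFrom (later {n} eq F) =
    subst (λ m → Excursion (config n) m (config (suc n))) eq (excursion n) (nextHit-firstJustFrom F)

  hits₁-step : ∀ n → hitsOf one (target n) + occurrences two (occurrences one n)
                     ≡ occurrences two (occurrences one (suc n))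
  hits₁-step n with r n
  ... | two with r (occurrences two n)
  ...   | one = refl
  ...   | two = refl
  hits₁-step n | one with r (occurrences one n)
  ...   | one = refl
  ...   | two = refl

  hits₂-step : ∀ n → hitsOf two (target n) + occurrences one (occurrences two n)
                     ≡ occurrences one (occurrences two (suc n))
  hits₂-step n with r n
  ... | one with r (occurrences one n)
  ...   | one = refl
  ...   | two = refl
  hits₂-step n | two with r (occurrences two n)
  ...   | one = refl
  ...   | two = refl

  hits₁ : ∀ n → sum< (hitsOf one ∘ target) n ≡ occurrences two (occurrences one n)
  hits₁ zero    = refl
  hits₁ (suc n) = trans (cong (hitsOf one (target n) +_) (hits₁ n)) (hits₁-step n)

  hits₂ : ∀ n → sum< (hitsOf two ∘ target) n ≡ occurrences one (occurrences two n)
  hits₂ zero    = refl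
  hits₂ (suc n) = trans (cong (hitsOf two (target n) +_) (hits₂ n)) (hits₂-step n)

  indicator-periodic : ∀ {M} → Periodic r M → ∀ s → Periodic (λ i → eqSt (r i) s) M
  indicator-periodic per s n = cong (λ t → eqSt t s) (per n)

  N : ℕ
  N = P * P

  0<N : 0 < N
  0<N = *-mono-≤ 0<P 0<P

  occurrences-* : ∀ s m → occurrences s (m * P) ≡ m * occurrences s P
  occurrences-* s = sum<-*-period (indicator-periodic r-periodic s)

  occurrences-N : ∀ s → occurrences s N ≡ occurrences s P * P
  occurrences-N s = trans (occurrences-* s P) (*-comm P _)

  r-periodic-N : Periodic r N
  r-periodic-N = periodic-* r-periodic P

  r∘occurrences-periodic : ∀ s → Periodic (r ∘ occurrences s) N
  r∘occurrences-periodic s n = begin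
    r (occurrences s (n + N))                 ≡⟨ cong r (sum<-+-period (indicator-periodic r-periodic-N s) n) ⟩
    r (occurrences s n + occurrences s N)     ≡⟨ cong (λ m → r (occurrences s n + m)) (occurrences-N s) ⟩
    r (occurrences s n + occurrences s P * P) ≡⟨ periodic-* r-periodic (occurrences s P) (occurrences s n) ⟩
    r (occurrences s n)                       ∎

  target-periodic : Periodic target N
  target-periodic n
    rewrite r-periodic-N n | r∘occurrences-periodic one n | r∘occurrences-periodic two n = refl

  hits₁-N : sum< (hitsOf one ∘ target) N ≡ occurrences one P * occurrences two P
  hits₁-N = trans (hits₁ N) (trans (cong (occurrences two) (occurrences-N one)) (occurrences-* two (occurrences one P)))

  hits₂-N : sum< (hitsOf two ∘ target) N ≡ occurrences two P * occurrences one P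
  hits₂-N = trans (hits₂ N) (trans (cong (occurrences one) (occurrences-N two)) (occurrences-* one (occurrences two P)))

  occurrences-pos : ∀ {s i n} → i < n → r i ≡ s → 0 < occurrences s n
  occurrences-pos {s} i<n ri≡s = sum<-pos _ i<n (subst (λ t → 0 < eqSt t s) (sym ri≡s) (eqSt-pos s))

  0<occurrences-two : 0 < occurrences two P
  0<occurrences-two = occurrences-pos (m%n<n n₀ P) (trans (periodic-% r-periodic n₀) r-n₀≡two)
    where
    instance
      P-nonZero : NonZero P
      P-nonZero = >-nonZero 0<P
    n₀ : ℕ
    n₀ = proj₁ hasTwo
    r-n₀≡two : r n₀ ≡ two
    r-n₀≡two = proj₂ hasTwo

  some-target : ∃₂ λ i t → target i ≡ just t
  some-target = just-of-sum<-pos (λ t → eqSt t one) N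
    (subst (0 <_) (sym hits₁-N) (*-mono-≤ (occurrences-pos 0<P first) 0<occurrences-two))

  open Compression target 0<N target-periodic (proj₂ (proj₂ some-target)) public

  hittingSequence : IsHittingSeq U D r compressed
  hittingSequence = config ∘ start , refl , λ k → nextHit-firstJustFrom (next-first (start k))

  balanced : Balanced compressed
  balanced = period , 0<period , compressed-periodic , (begin
    count compressed one period                 ≡⟨ count≡sum< compressed one period ⟩
    sum< (λ i → eqSt (compressed i) one) period ≡⟨ sum<-compressed-period (λ t → eqSt t one) ⟩
    sum< (hitsOf one ∘ target) N                ≡⟨ hits₁-N ⟩
    occurrences one P * occurrences two P       ≡⟨ *-comm (occurrences one P) _ ⟩
    occurrences two P * occurrences one P       ≡⟨ hits₂-N ⟨
    sum< (hitsOf two ∘ target) N                ≡⟨ sum<-compressed-period (λ t → eqSt t two) ⟨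
    sum< (λ i → eqSt (compressed i) two) period ≡⟨ count≡sum< compressed two period ⟨
    count compressed two period                 ∎)

theorem5p2 : (r : TwoStateRotor) → Σ (ℕ → St) λ h → IsHittingSeq U D (TwoStateRotor.seq r) h × Balanced h
theorem5p2 R = compressed , hittingSequence , balanced
  where open UD R
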